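{- If $\mathbb{A}$ is an $\mathcal{L}$-algebra (for an LE-signature $\mathcal{L}$), then its filter-ideal frame $\mathbb{F}^\star_{\mathbb{A}}$ is an $\mathcal{L}$-frame.
   Context: LE-signature $\mathcal{L}(\mathcal F,\mathcal G)$: each $f\in\mathcal F$, $g\in\mathcal G$ has an arity $n_f,n_g$ and order type $\epsilon_f\in\{1,\partial\}^{n_f}$, $\epsilon_g\in\{1,\partial\}^{n_g}$. An $\mathcal{L}$-algebra is a bounded lattice with operations $f$ preserving finite joins (incl. $\bot$) in coordinates with $\epsilon_f(i)=1$ and sending finite meets (incl. $\top$) to joins in coordinates with $\epsilon_f(i)=\partial$, and operations $g$ preserving finite meets in coordinates with $\epsilon_g(i)=1$ and sending finite joins to meets in coordinates with $\epsilon_g(i)=\partial$. Polarity $(W,U,N)$, $N\subseteq W\times U$; $X^\uparrow=\{u\mid wNu\ \forall w\in X\}$, $Y^\downarrow=\{w\mid wNu\ \forall u\in Y\}$; $X\subseteq W$ stable iff $X^{\uparrow\downarrow}=X$, $Y\subseteq U$ stable iff $Y^{\downarrow\uparrow}=Y$. For $S\subseteq A\times B_1\times\dots\times B_n$, $S^{(0)}[\overline C]=\{a\mid (a,\overline b)\in S\ \forall b_k\in C_k\}$, and $S^{(i)}[A',\overline C^i]$ is the set of $b\in B_i$ such that every tuple with first entry in $A'$, $i$-th entry $b$ and $k$-th entry in $C_k$ ($k\neq i$) lies in $S$ ($\overline C^i$: tuple with $i$-th entry removed; singletons written without braces). An $\mathcal{L}$-frame is $(W,U,N,(R_f),(R_g))$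 with $(W,U,N)$ a polarity, $R_f\subseteq U\times W^{\epsilon_f}$, $R_g\subseteq W\times U^{\epsilon_g}$ (where $W^\epsilon=\prod_i W^{\epsilon(i)}$, $U^\epsilon=\prod_iU^{\epsilon(i)}$, $W^1=U^\partial=W$, $W^\partial=U^1=U$), such that for all $w_0\in W,u_0\in U,\overline w\in W^{\epsilon_f},\overline u\in U^{\epsilon_g}$ and all $i$, the sets $R_f^{(0)}[\overline w]$, $R_f^{(i)}[u_0,\overline w^i]$, $R_g^{(0)}[\overline u]$, $R_g^{(i)}[w_0,\overline u^i]$ are stable. The filter-ideal frame of $\mathbb{A}$ is $\mathbb{F}^\star_\mathbb{A}=(\mathfrak F_\mathbb{A},\mathfrak I_\mathbb{A},N^\star,(R^\star_f),(R^\star_g))$: $\mathfrak F_\mathbb{A}$ the set of filters, $\mathfrak I_\mathbb{A}$ the set of ideals of $\mathbb{A}$; $FN^\star I$ iff $F\cap I\neq\varnothing$; for $\overline F$ with $F_i$ a filter if $\epsilon_f(i)=1$ and an ideal if $\epsilon_f(i)=\partial$, $R^\star_f(I,\overline F)$ iff $f(\overline a)\in I$ for some $\overline a$ with $a_i\in F_i$ for all $i$; for $\overline I$ with $I_i$ an ideal if $\epsilon_g(i)=1$ and a filter if $\epsilon_g(i)=\partial$, $R^\star_g(F,\overline I)$ iff $g(\overline a)\in F$ for some $\overline a$ with $a_i\in I_i$ for all $i$. -}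

module Defs where

open import Level using (Level; _⊔_)
open import Data.Nat using (ℕ)
open import Data.Fin using (Fin; zero; suc)
open import Data.Product using (Σ; ∃; _×_; _,_)
open import Relation.Unary using (Pred; _⊆_)
open import Relation.Binary.PropositionalEquality using (_≡_)
open import Relation.Binary.Lattice.Bundles using (BoundedLattice)

data Pol : Set where
  one  : Pol
  dual : Pol

data Sort : Set where
  sW : Sort
  sU : Sort

-- sort of the i-th coordinate of W^ε  (W^1 = W, W^∂ = U)
fSort : Pol → Sort
fSort one  = sW
fSort dual = sU

-- sort of the i-th coordinate of U^ε  (U^1 = U, U^∂ = W)
gSort : Pol → Sort
gSort one  = sU
gSort dual = sW

upd : ∀ {a} {n : ℕ} {T : Fin n → Set a} →
      ((j : Fin n) → T j) → (i : Fin n) → T i → (j : Fin n) → T j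
upd w zero    x zero    = x
upd w zero    x (suc j) = w (suc j)
upd w (suc i) x zero    = w zero
upd w (suc i) x (suc j) = upd (λ k → w (suc k)) i x j

record LESig : Set₁ where
  field
    FSym  : Set
    GSym  : Set
    arF   : FSym → ℕ
    arG   : GSym → ℕ
    εF    : (f : FSym) → Fin (arF f) → Pol
    εG    : (g : GSym) → Fin (arG g) → Pol

record LEAlgebra (𝓛 : LESig) {c ℓ₁ ℓ₂ : Level} (L : BoundedLattice c ℓ₁ ℓ₂)
       : Set (c ⊔ ℓ₁) where
  open LESig 𝓛
  open BoundedLattice L
  field
    fOp : (f : FSym) → (Fin (arF f) → Carrier) → Carrier
    gOp : (g : GSym) → (Fin (arG g) → Carrier) → Carrier
    fCong : ∀ f (a b : Fin (arF f) → Carrier) →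
            (∀ i → a i ≈ b i) → fOp f a ≈ fOp f b
    gCong : ∀ g (a b : Fin (arG g) → Carrier) →
            (∀ i → a i ≈ b i) → gOp g a ≈ gOp g b
    fJoin   : ∀ f (a : Fin (arF f) → Carrier) i → εF f i ≡ one →
              ∀ x y → fOp f (upd a i (x ∨ y)) ≈ fOp f (upd a i x) ∨ fOp f (upd a i y)
    fBot    : ∀ f (a : Fin (arF f) → Carrier) i → εF f i ≡ one →
              fOp f (upd a i ⊥) ≈ ⊥
    fMeet   : ∀ f (a : Fin (arF f) → Carrier) i → εF f i ≡ dual →
              ∀ x y → fOp f (upd a i (x ∧ y)) ≈ fOp f (upd a i x) ∨ fOp f (upd a i y)
    fTop    : ∀ f (a : Fin (arF f) → Carrier) i → εF f i ≡ dual →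
              fOp f (upd a i ⊤) ≈ ⊥
    gMeet   : ∀ g (a : Fin (arG g) → Carrier) i → εG g i ≡ one →
              ∀ x y → gOp g (upd a i (x ∧ y)) ≈ gOp g (upd a i x) ∧ gOp g (upd a i y)
    gTop    : ∀ g (a : Fin (arG g) → Carrier) i → εG g i ≡ one →
              gOp g (upd a i ⊤) ≈ ⊤
    gJoin   : ∀ g (a : Fin (arG g) → Carrier) i → εG g i ≡ dual →
              ∀ x y → gOp g (upd a i (x ∨ y)) ≈ gOp g (upd a i x) ∧ gOp g (upd a i y)
    gBot    : ∀ g (a : Fin (arG g) → Carrier) i → εG g i ≡ dual →
              gOp g (upd a i ⊥) ≈ ⊤

module Polarity {a r : Level} (W U : Set a) (N : W → U → Set r) where

  _↑ : ∀ {ℓ} → Pred W ℓ → Pred U (a ⊔ r ⊔ ℓ)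
  (X ↑) u = ∀ w → X w → N w u

  _↓ : ∀ {ℓ} → Pred U ℓ → Pred W (a ⊔ r ⊔ ℓ)
  (Y ↓) w = ∀ u → Y u → N w u

  StableW : ∀ {ℓ} → Pred W ℓ → Set (a ⊔ r ⊔ ℓ)
  StableW X = (((X ↑) ↓) ⊆ X) × (X ⊆ ((X ↑) ↓))

  StableU : ∀ {ℓ} → Pred U ℓ → Set (a ⊔ r ⊔ ℓ)
  StableU Y = (((Y ↓) ↑) ⊆ Y) × (Y ⊆ ((Y ↓) ↑))

  Car : Sort → Set a
  Car sW = W
  Car sU = U

  Stable : ∀ {ℓ} (s : Sort) → Pred (Car s) ℓ → Set (a ⊔ r ⊔ ℓ)
  Stable sW X = StableW X
  Stable sU Y = StableU Y

record IsLFrame (𝓛 : LESig) {a r : Level} (W U : Set a) (N : W → U → Set r)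
       (Rf : (f : LESig.FSym 𝓛) → U →
             ((i : Fin (LESig.arF 𝓛 f)) → Polarity.Car W U N (fSort (LESig.εF 𝓛 f i))) → Set r)
       (Rg : (g : LESig.GSym 𝓛) → W →
             ((i : Fin (LESig.arG 𝓛 g)) → Polarity.Car W U N (gSort (LESig.εG 𝓛 g i))) → Set r)
       : Set (a ⊔ r) where
  open LESig 𝓛
  open Polarity W U N
  field
    stableF₀ : ∀ f (w̄ : (i : Fin (arF f)) → Car (fSort (εF f i))) →
               StableU (λ u → Rf f u w̄)
    -- R_f^{(i)}[u₀, w̄^i] ⊆ W^{ε_f(i)} is stable (entry i of w̄ is ignored)
    stableFᵢ : ∀ f (u₀ : U) (w̄ : (i : Fin (arF f)) → Car (fSort (εF f i))) (i : Fin (arF f)) →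
               Stable (fSort (εF f i))
                 (λ x → Rf f u₀ (upd {T = λ j → Car (fSort (εF f j))} w̄ i x))
    stableG₀ : ∀ g (ū : (i : Fin (arG g)) → Car (gSort (εG g i))) →
               StableW (λ w → Rg g w ū)
    -- R_g^{(i)}[w₀, ū^i] ⊆ U^{ε_g(i)} is stable (entry i of ū is ignored)
    stableGᵢ : ∀ g (w₀ : W) (ū : (i : Fin (arG g)) → Car (gSort (εG g i))) (i : Fin (arG g)) →
               Stable (gSort (εG g i))
                 (λ x → Rg g w₀ (upd {T = λ j → Car (gSort (εG g j))} ū i x))

module FilterIdeal {c ℓ₁ ℓ₂ : Level} (L : BoundedLattice c ℓ₁ ℓ₂) where
  open BoundedLattice L

  ℓF : Level
  ℓF = c ⊔ ℓ₁ ⊔ ℓ₂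

  record IsFilter (P : Pred Carrier ℓF) : Set ℓF where
    field
      top∈   : P ⊤
      upward : ∀ {x y} → x ≤ y → P x → P y
      meet∈  : ∀ {x y} → P x → P y → P (x ∧ y)

  record IsIdeal (P : Pred Carrier ℓF) : Set ℓF where
    field
      bot∈     : P ⊥
      downward : ∀ {x y} → y ≤ x → P x → P y
      join∈    : ∀ {x y} → P x → P y → P (x ∨ y)

  Filt : Set (Level.suc ℓF)
  Filt = Σ (Pred Carrier ℓF) IsFilter

  Idl : Set (Level.suc ℓF)
  Idl = Σ (Pred Carrier ℓF) IsIdeal

  N⋆ : Filt → Idl → Set ℓF
  N⋆ (F , _) (I , _) = ∃ λ x → F x × I x

  open Polarity Filt Idl N⋆ using (Car)

  mem : (s : Sort) → Car s → Pred Carrier ℓF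
  mem sW (F , _) = F
  mem sU (I , _) = I

  module _ (𝓛 : LESig) (𝔸 : LEAlgebra 𝓛 L) where
    open LESig 𝓛
    open LEAlgebra 𝔸

    R⋆f : (f : FSym) → Idl → ((i : Fin (arF f)) → Car (fSort (εF f i))) → Set ℓF
    R⋆f f (I , _) F̄ =
      ∃ λ (ā : Fin (arF f) → Carrier) → (∀ i → mem (fSort (εF f i)) (F̄ i) (ā i)) × I (fOp f ā)

    R⋆g : (g : GSym) → Filt → ((i : Fin (arG g)) → Car (gSort (εG g i))) → Set ℓF
    R⋆g g (F , _) Ī =
      ∃ λ (ā : Fin (arG g) → Carrier) → (∀ i → mem (gSort (εG g i)) (Ī i) (ā i)) × F (gOp g ā)

-- Each section of a relation of the filter-ideal frame (fix all arguments but one) is the set of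
-- filters, resp. ideals, that meet one fixed ideal, resp. filter J, and any such set {y}↓ or {x}↑
-- is stable in a polarity. For the section in the first argument, J is generated by the values
-- h(ā) with ā ranging over the given filters/ideals; for the section in coordinate i, J consists
-- of the a with h(ā[i ↦ a]) in the fixed target. That J is closed under the relevant finite meets
-- or joins is exactly the (co)distributivity of h in coordinate i, combined with the monotonicity
-- of h in all coordinates, which these laws imply.
module Submission where

open import Defs
open import Level using (Level; _⊔_)
open import Relation.Binary.Lattice.Bundles using (BoundedLattice)
open import Data.Nat using (zero; suc)
open import Data.Fin using (Fin; zero; suc)
open import Data.Fin.Properties using (suc-injective)
open import Data.Product using (∃; _×_; _,_; proj₁; proj₂)
open import Relation.Binary.PropositionalEquality as ≡ using (_≡_; _≢_)
open import Relation.Nullary using (contradiction)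
open import Relation.Unary using (Pred)

opp : Sort → Sort
opp sW = sU
opp sU = sW

module _ {a r : Level} {W U : Set a} {N : W → U → Set r} where
  open Polarity W U N

  Incident : (s : Sort) → Car s → Car (opp s) → Set r
  Incident sW w u = N w u
  Incident sU u w = N w u

  incident-stable : ∀ {ℓ} s (Q : Pred (Car s) ℓ) (y : Car (opp s)) →
                    (∀ x → Q x → Incident s x y) → (∀ x → Incident s x y → Q x) →
                    Stable s Q
  incident-stable sW Q u Q⇒N N⇒Q = (λ {w} w∈Q↑↓ → N⇒Q w (w∈Q↑↓ u Q⇒N)) , (λ w∈Q u u∈Q↑ → u∈Q↑ _ w∈Q)
  incident-stable sU Q w Q⇒N N⇒Q = (λ {u} u∈Q↓↑ → N⇒Q u (u∈Q↓↑ w Q⇒N)) , (λ u∈Q w w∈Q↓ → w∈Q↓ _ u∈Q)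

module _ {a b r : Level} {A : Set b} where

  Pointwise-upd : ∀ {n} {T : Fin n → Set a} (R : (j : Fin n) → T j → A → Set r)
                  (w : (j : Fin n) → T j) (c : Fin n → A) i {x y} → R i x y →
                  (∀ j → j ≢ i → R j (w j) (c j)) → ∀ j → R j (upd w i x j) (upd c i y j)
  Pointwise-upd R w c zero    Rxy _    zero    = Rxy
  Pointwise-upd R w c zero    _   rest (suc j) = rest (suc j) (λ ())
  Pointwise-upd R w c (suc i) _   rest zero    = rest zero (λ ())
  Pointwise-upd R w c (suc i) Rxy rest (suc j) =
    Pointwise-upd (λ k → R (suc k)) (λ k → w (suc k)) (λ k → c (suc k)) i Rxy
      (λ k k≢i → rest (suc k) (λ eq → k≢i (suc-injective eq))) j

  Pointwise-upd-at : ∀ {n} {T : Fin n → Set a} (R : (j : Fin n) → T j → A → Set r)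
                     (w : (j : Fin n) → T j) (c : Fin n → A) i {x} →
                     (∀ j → R j (upd w i x j) (c j)) → R i x (c i)
  Pointwise-upd-at R w c zero    R-upd = R-upd zero
  Pointwise-upd-at R w c (suc i) R-upd =
    Pointwise-upd-at (λ k → R (suc k)) (λ k → w (suc k)) (λ k → c (suc k)) i (λ k → R-upd (suc k))

  Pointwise-upd-elsewhere : ∀ {n} {T : Fin n → Set a} (R : (j : Fin n) → T j → A → Set r)
                            (w : (j : Fin n) → T j) (c : Fin n → A) i {x} →
                            (∀ j → R j (upd w i x j) (c j)) → ∀ j → j ≢ i → R j (w j) (c j)
  Pointwise-upd-elsewhere R w c zero    R-upd zero    0≢0 = contradiction ≡.refl 0≢0
  Pointwise-upd-elsewhere R w c zero    R-upd (suc j) _   = R-upd (suc j)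
  Pointwise-upd-elsewhere R w c (suc i) R-upd zero    _   = R-upd zero
  Pointwise-upd-elsewhere R w c (suc i) R-upd (suc j) j≢i =
    Pointwise-upd-elsewhere (λ k → R (suc k)) (λ k → w (suc k)) (λ k → c (suc k)) i
      (λ k → R-upd (suc k)) j (λ eq → j≢i (≡.cong suc eq))

upd-self : ∀ {a} {A : Set a} {n} (c : Fin n → A) i j → upd c i (c i) j ≡ c j
upd-self c zero    zero    = ≡.refl
upd-self c zero    (suc j) = ≡.refl
upd-self c (suc i) zero    = ≡.refl
upd-self c (suc i) (suc j) = upd-self (λ k → c (suc k)) i j

module FilterIdealFrame {c ℓ₁ ℓ₂ : Level} (L : BoundedLattice c ℓ₁ ℓ₂) where
  open BoundedLattice L
  open FilterIdeal L
  open Polarity Filt Idl N⋆ using (Car; Stable)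

  _≤[_]_ : Carrier → Sort → Carrier → Set ℓ₂
  x ≤[ sW ] y = x ≤ y
  x ≤[ sU ] y = y ≤ x

  _∧[_]_ : Carrier → Sort → Carrier → Carrier
  x ∧[ sW ] y = x ∧ y
  x ∧[ sU ] y = x ∨ y

  ⊤[_] : Sort → Carrier
  ⊤[ sW ] = ⊤
  ⊤[ sU ] = ⊥

  refl[_] : ∀ s {x} → x ≤[ s ] x
  refl[ sW ] = refl
  refl[ sU ] = refl

  reflexive[_] : ∀ s {x y} → x ≈ y → x ≤[ s ] y
  reflexive[ sW ] x≈y = reflexive x≈y
  reflexive[ sU ] x≈y = reflexive (Eq.sym x≈y)

  trans[_] : ∀ s {x y z} → x ≤[ s ] y → y ≤[ s ] z → x ≤[ s ] z
  trans[ sW ] x≤y y≤z = trans x≤y y≤z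
  trans[ sU ] x≤y y≤z = trans y≤z x≤y

  antisym[_] : ∀ s {x y} → x ≤[ s ] y → y ≤[ s ] x → x ≈ y
  antisym[ sW ] = antisym
  antisym[ sU ] x≤y y≤x = antisym y≤x x≤y

  flip[_] : ∀ s {x y} → x ≤[ s ] y → y ≤[ opp s ] x
  flip[ sW ] x≤y = x≤y
  flip[ sU ] x≤y = x≤y

  unflip[_] : ∀ s {x y} → x ≤[ opp s ] y → y ≤[ s ] x
  unflip[ sW ] x≤y = x≤y
  unflip[ sU ] x≤y = x≤y

  maximum[_] : ∀ s x → x ≤[ s ] ⊤[ s ]
  maximum[ sW ] = maximum
  maximum[ sU ] = minimum

  x∧y≤[_]x : ∀ s x y → (x ∧[ s ] y) ≤[ s ] x
  x∧y≤[ sW ]x = x∧y≤x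
  x∧y≤[ sU ]x = x≤x∨y

  x∧y≤[_]y : ∀ s x y → (x ∧[ s ] y) ≤[ s ] y
  x∧y≤[ sW ]y = x∧y≤y
  x∧y≤[ sU ]y = y≤x∨y

  ∧-greatest[_] : ∀ s {x y z} → x ≤[ s ] y → x ≤[ s ] z → x ≤[ s ] (y ∧[ s ] z)
  ∧-greatest[ sW ] = ∧-greatest
  ∧-greatest[ sU ] = ∨-least

  IsFilter[_] : Sort → Pred Carrier ℓF → Set ℓF
  IsFilter[ sW ] = IsFilter
  IsFilter[ sU ] = IsIdeal

  mem-isFilter : ∀ s (x : Car s) → IsFilter[ s ] (mem s x)
  mem-isFilter sW = proj₂
  mem-isFilter sU = proj₂

  mkFilter[_] : ∀ s {P : Pred Carrier ℓF} → P ⊤[ s ] → (∀ {x y} → x ≤[ s ] y → P x → P y) →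
                (∀ {x y} → P x → P y → P (x ∧[ s ] y)) → IsFilter[ s ] P
  mkFilter[ sW ] ⊤∈ up ∧∈ = record { top∈ = ⊤∈ ; upward = up ; meet∈ = ∧∈ }
  mkFilter[ sU ] ⊤∈ up ∧∈ = record { bot∈ = ⊤∈ ; downward = up ; join∈ = ∧∈ }

  ⊤∈[_] : ∀ s {P} → IsFilter[ s ] P → P ⊤[ s ]
  ⊤∈[ sW ] = IsFilter.top∈
  ⊤∈[ sU ] = IsIdeal.bot∈

  upward[_] : ∀ s {P} → IsFilter[ s ] P → ∀ {x y} → x ≤[ s ] y → P x → P y
  upward[ sW ] = IsFilter.upward
  upward[ sU ] = IsIdeal.downward

  ∧∈[_] : ∀ s {P} → IsFilter[ s ] P → ∀ {x y} → P x → P y → P (x ∧[ s ] y)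
  ∧∈[ sW ] = IsFilter.meet∈
  ∧∈[ sU ] = IsIdeal.join∈

  ≈-resp[_] : ∀ s {P} → IsFilter[ s ] P → ∀ {x y} → x ≈ y → P x → P y
  ≈-resp[ s ] isP x≈y = upward[ s ] isP (reflexive[ s ] x≈y)

  point : ∀ s (x : Car s) → ∃ (mem s x)
  point s x = ⊤[ s ] , ⊤∈[ s ] (mem-isFilter s x)

  meeting-stable : ∀ s (Q : Pred (Car s) ℓF) {J} → IsFilter[ opp s ] J →
                   (∀ x → Q x → ∃ λ a → mem s x a × J a) →
                   (∀ x a → mem s x a → J a → Q x) → Stable s Q
  meeting-stable sW Q isJ Q⇒meet meet⇒Q =
    incident-stable sW Q (_ , isJ) Q⇒meet (λ { F (a , Fa , Ja) → meet⇒Q F a Fa Ja })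
  meeting-stable sU Q isJ Q⇒meet meet⇒Q =
    incident-stable sU Q (_ , isJ)
      (λ I QI → let a , Ia , Ja = Q⇒meet I QI in a , Ja , Ia)
      (λ { I (a , Ja , Ia) → meet⇒Q I a Ia Ja })

  -- Coordinate i is a bounded meet homomorphism from the order of the dual of its sort to the
  -- order of the target sort t: this covers all four (co)distributivity laws of an LE-algebra.
  record IsLEOperation {n} (σ : Fin n → Sort) (t : Sort) (h : (Fin n → Carrier) → Carrier)
         : Set (c ⊔ ℓ₁) where
    field
      cong   : ∀ a b → (∀ j → a j ≈ b j) → h a ≈ h b
      ∧-homo : ∀ a i x y → h (upd a i (x ∧[ opp (σ i) ] y)) ≈ h (upd a i x) ∧[ t ] h (upd a i y)
      ⊤-homo : ∀ a i → h (upd a i ⊤[ opp (σ i) ]) ≈ ⊤[ t ]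

  module _ (𝓛 : LESig) (𝔸 : LEAlgebra 𝓛 L) where
    open LESig 𝓛
    open LEAlgebra 𝔸

    fOp-isLEOperation : ∀ f → IsLEOperation (λ j → fSort (εF f j)) sU (fOp f)
    fOp-isLEOperation f = record { cong = fCong f ; ∧-homo = ∧-homo ; ⊤-homo = ⊤-homo }
      where
      ∧-homo : ∀ a i x y → fOp f (upd a i (x ∧[ opp (fSort (εF f i)) ] y)) ≈ fOp f (upd a i x) ∨ fOp f (upd a i y)
      ∧-homo a i with εF f i in εi
      ... | one  = fJoin f a i εi
      ... | dual = fMeet f a i εi
      ⊤-homo : ∀ a i → fOp f (upd a i ⊤[ opp (fSort (εF f i)) ]) ≈ ⊥
      ⊤-homo a i with εF f i in εi
      ... | one  = fBot f a i εi
      ... | dual = fTop f a i εi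

    gOp-isLEOperation : ∀ g → IsLEOperation (λ j → gSort (εG g j)) sW (gOp g)
    gOp-isLEOperation g = record { cong = gCong g ; ∧-homo = ∧-homo ; ⊤-homo = ⊤-homo }
      where
      ∧-homo : ∀ a i x y → gOp g (upd a i (x ∧[ opp (gSort (εG g i)) ] y)) ≈ gOp g (upd a i x) ∧ gOp g (upd a i y)
      ∧-homo a i with εG g i in εi
      ... | one  = gMeet g a i εi
      ... | dual = gJoin g a i εi
      ⊤-homo : ∀ a i → gOp g (upd a i ⊤[ opp (gSort (εG g i)) ]) ≈ ⊤
      ⊤-homo a i with εG g i in εi
      ... | one  = gTop g a i εi
      ... | dual = gBot g a i εi

  monotone-if-coordinatewise : ∀ {n} t (R : Fin n → Carrier → Carrier → Set ℓ₂)
    (h : (Fin n → Carrier) → Carrier) → (∀ a b → (∀ j → a j ≡ b j) → h a ≈ h b) →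
    (∀ a i {x y} → R i x y → h (upd a i x) ≤[ t ] h (upd a i y)) →
    ∀ a b → (∀ j → R j (a j) (b j)) → h a ≤[ t ] h b
  monotone-if-coordinatewise {zero} t R h cong _ a b _ = reflexive[ t ] (cong a b (λ ()))
  monotone-if-coordinatewise {suc n} t R h cong mono₁ a b Rab =
    trans[ t ] (reflexive[ t ] (cong a (upd a zero (a zero)) (λ j → ≡.sym (upd-self a zero j))))
      (trans[ t ] (mono₁ a zero (Rab zero))
      (trans[ t ] (reflexive[ t ] (cong _ _ λ { zero → ≡.refl ; (suc j) → ≡.refl }))
      (trans[ t ] (monotone-if-coordinatewise t (λ j → R (suc j)) h-tail cong-tail mono₁-tail
                     (λ j → a (suc j)) (λ j → b (suc j)) (λ j → Rab (suc j)))
        (reflexive[ t ] (cong _ _ λ { zero → ≡.refl ; (suc j) → ≡.refl })))))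
    where
    _◂_ : ∀ {m} → Carrier → (Fin m → Carrier) → Fin (suc m) → Carrier
    (x ◂ c) zero    = x
    (x ◂ c) (suc j) = c j

    h-tail : (Fin n → Carrier) → Carrier
    h-tail c = h (b zero ◂ c)

    cong-tail : ∀ c d → (∀ j → c j ≡ d j) → h-tail c ≈ h-tail d
    cong-tail c d c≡d = cong _ _ λ { zero → ≡.refl ; (suc j) → c≡d j }

    mono₁-tail : ∀ c i {x y} → R (suc i) x y → h-tail (upd c i x) ≤[ t ] h-tail (upd c i y)
    mono₁-tail c i Rxy =
      trans[ t ] (reflexive[ t ] (cong _ _ λ { zero → ≡.refl ; (suc j) → ≡.refl }))
        (trans[ t ] (mono₁ (b zero ◂ c) (suc i) Rxy)
          (reflexive[ t ] (cong _ _ λ { zero → ≡.refl ; (suc j) → ≡.refl })))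

  module LEOperation {n} {σ : Fin n → Sort} {t : Sort} {h : (Fin n → Carrier) → Carrier}
                     (isOp : IsLEOperation σ t h) where
    open IsLEOperation isOp

    cong-≡ : ∀ a b → (∀ j → a j ≡ b j) → h a ≈ h b
    cong-≡ a b a≡b = cong a b (λ j → Eq.reflexive (a≡b j))

    monotone₁ : ∀ a i {x y} → x ≤[ opp (σ i) ] y → h (upd a i x) ≤[ t ] h (upd a i y)
    monotone₁ a i {x} {y} x≤y =
      trans[ t ] (reflexive[ t ] (cong _ _ (Pointwise-upd (λ _ u v → u ≈ v) a a i x≈x∧y (λ _ _ → Eq.refl))))
        (trans[ t ] (reflexive[ t ] (∧-homo a i x y)) (x∧y≤[ t ]y _ _))
      where
      x≈x∧y : x ≈ x ∧[ opp (σ i) ] y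
      x≈x∧y = antisym[ opp (σ i) ] (∧-greatest[ opp (σ i) ] refl[ opp (σ i) ] x≤y)
                                   (x∧y≤[ opp (σ i) ]x x y)

    monotone : ∀ a b → (∀ j → a j ≤[ opp (σ j) ] b j) → h a ≤[ t ] h b
    monotone = monotone-if-coordinatewise t (λ j x y → x ≤[ opp (σ j) ] y) h cong-≡ monotone₁

    monotone-upd : ∀ a b i x → (∀ j → a j ≤[ opp (σ j) ] b j) → h (upd a i x) ≤[ t ] h (upd b i x)
    monotone-upd a b i x a≤b =
      monotone _ _ (Pointwise-upd (λ j u v → u ≤[ opp (σ j) ] v) a b i refl[ opp (σ i) ] (λ j _ → a≤b j))

    _⊓_ : (Fin n → Carrier) → (Fin n → Carrier) → Fin n → Carrier
    (a ⊓ b) j = a j ∧[ σ j ] b j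

    ⊓-lowerˡ : ∀ a b j → a j ≤[ opp (σ j) ] (a ⊓ b) j
    ⊓-lowerˡ a b j = flip[ σ j ] (x∧y≤[ σ j ]x (a j) (b j))

    ⊓-lowerʳ : ∀ a b j → b j ≤[ opp (σ j) ] (a ⊓ b) j
    ⊓-lowerʳ a b j = flip[ σ j ] (x∧y≤[ σ j ]y (a j) (b j))

    -- For h = fOp f (resp. gOp g) this is definitionally R⋆f f (resp. R⋆g g).
    R⋆ : Car t → ((j : Fin n) → Car (σ j)) → Set ℓF
    R⋆ z x̄ = ∃ λ (ā : Fin n → Carrier) → (∀ j → mem (σ j) (x̄ j) (ā j)) × mem t z (h ā)

    R⋆-stable₀ : ∀ x̄ → Stable t (λ z → R⋆ z x̄)
    R⋆-stable₀ x̄ = meeting-stable t _ isJ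
        (λ { z (ā , ā∈x̄ , hā∈z) → h ā , hā∈z , ā , ā∈x̄ , refl[ opp t ] })
        (λ { z a a∈z (ā , ā∈x̄ , hā≤a) → ā , ā∈x̄ , upward[ t ] (mem-isFilter t z) (unflip[ t ] hā≤a) a∈z })
      where
      J : Pred Carrier ℓF
      J x = ∃ λ ā → (∀ j → mem (σ j) (x̄ j) (ā j)) × h ā ≤[ opp t ] x

      isJ : IsFilter[ opp t ] J
      isJ = mkFilter[ opp t ]
        ((λ j → proj₁ (point (σ j) (x̄ j))) , (λ j → proj₂ (point (σ j) (x̄ j))) , maximum[ opp t ] _)
        (λ { x≤y (ā , ā∈x̄ , hā≤x) → ā , ā∈x̄ , trans[ opp t ] hā≤x x≤y })
        (λ { (ā , ā∈x̄ , hā≤x) (b̄ , b̄∈x̄ , hb̄≤y) →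
             ā ⊓ b̄ , (λ j → ∧∈[ σ j ] (mem-isFilter (σ j) (x̄ j)) (ā∈x̄ j) (b̄∈x̄ j)) ,
             ∧-greatest[ opp t ] (trans[ opp t ] (flip[ t ] (monotone _ _ (⊓-lowerˡ ā b̄))) hā≤x)
                                 (trans[ opp t ] (flip[ t ] (monotone _ _ (⊓-lowerʳ ā b̄))) hb̄≤y) })

    R⋆-stableᵢ : ∀ z x̄ i → Stable (σ i) (λ x → R⋆ z (upd {T = λ j → Car (σ j)} x̄ i x))
    R⋆-stableᵢ z x̄ i = meeting-stable (σ i) _ isJ
        (λ { x (ā , ā∈x̄[i↦x] , hā∈z) →
             ā i , Pointwise-upd-at mem′ x̄ ā i ā∈x̄[i↦x] ,
             ā , Pointwise-upd-elsewhere mem′ x̄ ā i ā∈x̄[i↦x] ,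
             ≈-resp[ t ] z-isFilter (cong-≡ _ _ (λ j → ≡.sym (upd-self ā i j))) hā∈z })
        (λ { x a a∈x (ā , ā∈x̄ , hā[i↦a]∈z) → upd ā i a , Pointwise-upd mem′ x̄ ā i a∈x ā∈x̄ , hā[i↦a]∈z })
      where
      mem′ : (j : Fin n) → Car (σ j) → Carrier → Set ℓF
      mem′ j = mem (σ j)

      z-isFilter : IsFilter[ t ] (mem t z)
      z-isFilter = mem-isFilter t z

      J : Pred Carrier ℓF
      J x = ∃ λ ā → (∀ j → j ≢ i → mem (σ j) (x̄ j) (ā j)) × mem t z (h (upd ā i x))

      isJ : IsFilter[ opp (σ i) ] J
      isJ = mkFilter[ opp (σ i) ]
        (d̄ , (λ j _ → proj₂ (point (σ j) (x̄ j))) ,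
         ≈-resp[ t ] z-isFilter (Eq.sym (⊤-homo d̄ i)) (⊤∈[ t ] z-isFilter))
        (λ { x≤y (ā , ā∈x̄ , hā[i↦x]∈z) → ā , ā∈x̄ , upward[ t ] z-isFilter (monotone₁ ā i x≤y) hā[i↦x]∈z })
        (λ { {x} {y} (ā , ā∈x̄ , hā[i↦x]∈z) (b̄ , b̄∈x̄ , hb̄[i↦y]∈z) →
             ā ⊓ b̄ , (λ j j≢i → ∧∈[ σ j ] (mem-isFilter (σ j) (x̄ j)) (ā∈x̄ j j≢i) (b̄∈x̄ j j≢i)) ,
             ≈-resp[ t ] z-isFilter (Eq.sym (∧-homo (ā ⊓ b̄) i x y))
               (∧∈[ t ] z-isFilter (upward[ t ] z-isFilter (monotone-upd _ _ i x (⊓-lowerˡ ā b̄)) hā[i↦x]∈z)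
                                   (upward[ t ] z-isFilter (monotone-upd _ _ i y (⊓-lowerʳ ā b̄)) hb̄[i↦y]∈z)) })
        where
        d̄ : Fin n → Carrier
        d̄ j = proj₁ (point (σ j) (x̄ j))

mainTheorem5 : (𝓛 : LESig) {c ℓ₁ ℓ₂ : Level} (L : BoundedLattice c ℓ₁ ℓ₂) (𝔸 : LEAlgebra 𝓛 L) →
    let open FilterIdeal L in
    IsLFrame 𝓛 Filt Idl N⋆ (R⋆f 𝓛 𝔸) (R⋆g 𝓛 𝔸)
mainTheorem5 𝓛 L 𝔸 = record
  { stableF₀ = λ f → R⋆-stable₀ (fOp-isLEOperation 𝓛 𝔸 f)
  ; stableFᵢ = λ f → R⋆-stableᵢ (fOp-isLEOperation 𝓛 𝔸 f)
  ; stableG₀ = λ g → R⋆-stable₀ (gOp-isLEOperation 𝓛 𝔸 g)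
  ; stableGᵢ = λ g → R⋆-stableᵢ (gOp-isLEOperation 𝓛 𝔸 g)
  }
  where open FilterIdealFrame L
        open LEOperation
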